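{- Let $k\in\mathbb{Z}^+$, $n\ge 2k+1$, and let $i,j\in[n]$ be distinct. The number of permutations $\pi\in\mathcal{S}_n$ satisfying $\pi^k(i)=i$ and $\pi^k(j)=j$ is $$\left(\tau^2(k)-\tau(k)+\sigma(k)\right)(n-2)!.$$
   Context: $\mathcal{S}_n$ is the symmetric group on $[n]=\{1,\dots,n\}$. $\tau(k)$ is the number of positive divisors of $k$ and $\sigma(k)$ is their sum. -}

module Defs where

open import Data.Nat using (ℕ; zero; suc; _+_)
open import Data.Nat.Divisibility using (_∣_; _∣?_)
open import Data.Fin using (Fin)
open import Data.Fin.Properties using (all?; _≟_)
open import Data.Vec using (Vec; []; _∷_; lookup)
open import Data.List using (List; []; _∷_; [_]; map; concatMap; allFin; filter; length; upTo)
open import Data.Nat.ListAction using (sum)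
open import Data.Product using (_×_)
open import Relation.Binary.PropositionalEquality using (_≡_)
open import Relation.Nullary.Decidable using (Dec; _→-dec_; _×-dec_)

allVecs : (n m : ℕ) → List (Vec (Fin n) m)
allVecs n zero = [ [] ]
allVecs n (suc m) = concatMap (λ x → map (x ∷_) (allVecs n m)) (allFin n)

-- A table v : Vec (Fin n) n represents the map a ↦ lookup v a; it is a
-- permutation of [n] iff this map is injective (equivalently bijective).
IsPerm : {n : ℕ} → Vec (Fin n) n → Set
IsPerm {n} v = (a b : Fin n) → lookup v a ≡ lookup v b → a ≡ b

isPerm? : {n : ℕ} → (v : Vec (Fin n) n) → Dec (IsPerm v)
isPerm? v = all? (λ a → all? (λ b → (lookup v a ≟ lookup v b) →-dec (a ≟ b)))

Sym : (n : ℕ) → List (Vec (Fin n) n)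
Sym n = filter isPerm? (allVecs n n)

pow : {n : ℕ} → Vec (Fin n) n → ℕ → Fin n → Fin n
pow π zero x = x
pow π (suc k) x = lookup π (pow π k x)

countFix2 : (n k : ℕ) → Fin n → Fin n → ℕ
countFix2 n k i j =
  length (filter (λ π → (pow π k i ≟ i) ×-dec (pow π k j ≟ j)) (Sym n))

divisors : ℕ → List ℕ
divisors k = filter (_∣? k) (map suc (upTo k))

τ : ℕ → ℕ
τ k = length (divisors k)

σ : ℕ → ℕ
σ k = sum (divisors k)

{-# OPTIONS --safe #-}
-- Induct on n through the bijection [n+1] × S_n ≅ S_(n+1) that inserts the new point p right
-- after c on the cycle of π (as a fixed point when c = p). Insertion lengthens exactly the cycle
-- through c, so the number of permutations in which i, j lie in distinct cycles of lengths a, b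
-- (resp. in one cycle of length a) satisfies a simple recurrence, whose solution is (n-2)! for
-- a + b ≤ n (resp. (a-1)(n-2)! for a ≤ n). As π^k(x) = x iff the cycle length of x divides k,
-- summing over divisors a, b of k (a + b ≤ 2k < n) gives τ(k)²(n-2)! + Σ_{d ∣ k} (d-1)(n-2)!.
module Submission where

open import Defs
open import Data.Bool using (Bool; true; false; not; _∧_; _∨_)
open import Data.Bool.Properties using (∧-zeroʳ; ∧-idem)
open import Data.Fin using (Fin; zero; suc; toℕ; fromℕ<; punchIn; punchOut)
open import Data.Fin.Properties
  using (_≟_; pigeonhole; toℕ<n; toℕ-fromℕ<; toℕ-injective; punchIn-injective; punchInᵢ≢i; punchIn-punchOut;
         punchOut-injective)
open import Data.List using (List; []; _∷_; _++_; map; concatMap; allFin; filter; length; tabulate; upTo)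
open import Data.List.Membership.Propositional using (_∈_; find)
open import Data.List.Membership.Propositional.Properties
  using (∈-map⁺; ∈-map⁻; ∈-concatMap⁺; ∈-concatMap⁻; ∈-allFin; ∈-filter⁺; ∈-filter⁻; ∈-tabulate⁺; ∈-tabulate⁻;
         ∈-upTo⁺; ∈-upTo⁻)
open import Data.List.Membership.Propositional.Properties.WithK using (unique∧set⇒bag)
open import Data.List.Properties using (map-++; map-∘; map-id; length-tabulate)
open import Data.List.Relation.Binary.BagAndSetEquality using (∼bag⇒↭)
open import Data.List.Relation.Binary.Permutation.Propositional using (_↭_)
import Data.List.Relation.Binary.Permutation.Propositional.Properties as ↭
open ↭ using (↭-length)
open import Data.List.Relation.Unary.All using ([])
open import Data.List.Relation.Unary.All.Properties using (¬Any⇒All¬)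
open import Data.List.Relation.Unary.Any using (here; there)
import Data.List.Relation.Unary.Any as Any
open import Data.List.Relation.Unary.Unique.Propositional using (Unique; []; _∷_)
import Data.List.Relation.Unary.Unique.Propositional.Properties as Unique
open import Data.Nat
  using (ℕ; zero; suc; pred; ≢-nonZero; _+_; _*_; _∸_; _≤_; _<_; z≤n; z<s; s≤s; s≤s⁻¹; s<s⁻¹; _!)
open import Data.Nat.DivMod using (_%_; _/_; m≡m%n+[m/n]*n; m%n<n)
open import Data.Nat.Divisibility using (_∣_; _∣?_; divides; m%n≡0⇒n∣m; ∣⇒≤)
open import Data.Nat.ListAction using (sum)
open import Data.Nat.Tactic.RingSolver using (solve-∀)
open import Data.Nat.ListAction.Properties using (sum-++; sum-↭)
import Data.Nat.Properties as ℕ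
open import Data.Nat.Properties
  using (+-commutativeSemigroup; *-zeroʳ; *-distribˡ-+; *-distribʳ-+; +-suc; m≤n+m; n<1+n;
         ≤-<-trans; <-≤-trans; <-cmp; m≤n⇒∃[o]m+o≡n; +-comm; *-suc; +-identityʳ; *-identityˡ; *-identityʳ;
         m+n∸m≡n; ∸-+-assoc; m∸n+n≡m; m≤n⇒m≤1+n; ≤-antisym; ≰⇒>; +-assoc; +-monoʳ-≤; +-mono-≤;
         ≤-trans; m≤m+n; m≤m*n; n≤1+n; module ≤-Reasoning)
open import Algebra.Properties.CommutativeSemigroup +-commutativeSemigroup using (interchange)
open import Data.Product using (∃; _×_; _,_; proj₁; proj₂)
open import Data.Vec using (Vec; []; _∷_; lookup)
import Data.Vec as Vec using (tabulate)
import Data.Vec.Properties as Vecₚ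
open import Function using (id; _∘_; _⇔_; mk⇔; Equivalence)
open import Function.Definitions using (Injective)
open import Relation.Binary.PropositionalEquality
open import Relation.Binary using (tri<; tri≈; tri>; DecidableEquality)
open import Relation.Nullary using (Dec; does; yes; no; ¬_; contradiction)
import Relation.Nullary.Decidable as Dec
open import Relation.Nullary.Decidable using (does-⇔; dec-true; dec-false; _×-dec_)
open import Relation.Unary using (Pred; Decidable)

variable
  A B : Set

⟦_⟧ : Bool → ℕ
⟦ true ⟧ = 1
⟦ false ⟧ = 0

∑ : List A → (A → ℕ) → ℕ
∑ xs f = sum (map f xs)

syntax ∑ xs (λ x → e) = ∑[ x ∈ xs ] e

∑-cong : ∀ xs {f g : A → ℕ} → (∀ {x} → x ∈ xs → f x ≡ g x) → ∑ xs f ≡ ∑ xs g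
∑-cong [] _ = refl
∑-cong (x ∷ xs) f≗g = cong₂ _+_ (f≗g (here refl)) (∑-cong xs (f≗g ∘ there))

∑-distrib-+ : ∀ xs (f g : A → ℕ) → ∑[ x ∈ xs ] (f x + g x) ≡ ∑ xs f + ∑ xs g
∑-distrib-+ [] f g = refl
∑-distrib-+ (x ∷ xs) f g =
  trans (cong (f x + g x +_) (∑-distrib-+ xs f g)) (interchange (f x) (g x) _ _)

∑-*ˡ : ∀ xs c (f : A → ℕ) → ∑[ x ∈ xs ] (c * f x) ≡ c * ∑ xs f
∑-*ˡ [] c f = sym (*-zeroʳ c)
∑-*ˡ (x ∷ xs) c f = trans (cong (c * f x +_) (∑-*ˡ xs c f)) (sym (*-distribˡ-+ c (f x) _))

∑-*ʳ : ∀ xs (f : A → ℕ) c → ∑[ x ∈ xs ] (f x * c) ≡ ∑ xs f * c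
∑-*ʳ [] f c = refl
∑-*ʳ (x ∷ xs) f c = trans (cong (f x * c +_) (∑-*ʳ xs f c)) (sym (*-distribʳ-+ c (f x) _))

∑-linear : ∀ xs k l (f g : A → ℕ) → ∑[ x ∈ xs ] (k * f x + l * g x) ≡ k * ∑ xs f + l * ∑ xs g
∑-linear xs k l f g = trans (∑-distrib-+ xs _ _) (cong₂ _+_ (∑-*ˡ xs k f) (∑-*ˡ xs l g))

∑-linear₃ : ∀ xs k l r (f g h : A → ℕ) →
            ∑[ x ∈ xs ] (k * f x + l * g x + r * h x) ≡ k * ∑ xs f + l * ∑ xs g + r * ∑ xs h
∑-linear₃ xs k l r f g h = trans (∑-distrib-+ xs _ _) (cong₂ _+_ (∑-linear xs k l f g) (∑-*ˡ xs r h))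

∑-const : ∀ xs c → ∑[ _ ∈ xs ] c ≡ length {A = A} xs * c
∑-const [] c = refl
∑-const (x ∷ xs) c = cong (c +_) (∑-const xs c)

∑-zero : (xs : List A) → ∑[ _ ∈ xs ] 0 ≡ 0
∑-zero xs = trans (∑-const xs 0) (*-zeroʳ (length xs))

∑-++ : ∀ xs ys (f : A → ℕ) → ∑ (xs ++ ys) f ≡ ∑ xs f + ∑ ys f
∑-++ xs ys f = trans (cong sum (map-++ f xs ys)) (sum-++ (map f xs) (map f ys))

∑-concatMap : ∀ (g : A → List B) xs f → ∑ (concatMap g xs) f ≡ ∑[ x ∈ xs ] ∑ (g x) f
∑-concatMap g [] f = refl
∑-concatMap g (x ∷ xs) f =
  trans (∑-++ (g x) (concatMap g xs) f) (cong (∑ (g x) f +_) (∑-concatMap g xs f))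

∑-map : ∀ (g : A → B) xs f → ∑ (map g xs) f ≡ ∑[ x ∈ xs ] f (g x)
∑-map g xs f = cong sum (sym (map-∘ xs))

∑-comm : ∀ xs ys (h : A → B → ℕ) → ∑[ x ∈ xs ] ∑[ y ∈ ys ] h x y ≡ ∑[ y ∈ ys ] ∑[ x ∈ xs ] h x y
∑-comm [] ys h = sym (∑-zero ys)
∑-comm (x ∷ xs) ys h =
  trans (cong (∑ ys (h x) +_) (∑-comm xs ys h)) (sym (∑-distrib-+ ys (h x) _))

length-filter : ∀ {ℓ} {P : Pred A ℓ} (P? : Decidable P) xs →
                length (filter P? xs) ≡ ∑[ x ∈ xs ] ⟦ does (P? x) ⟧
length-filter P? [] = refl
length-filter P? (x ∷ xs) with does (P? x)
... | true = cong suc (length-filter P? xs)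
... | false = length-filter P? xs

∑-partition : {A : Set} (xs : List A) (b d : A → Bool) (h : ℕ → ℕ → ℕ) → (∀ x → b x ∧ d x ≡ false) →
              let β = ∑[ x ∈ xs ] ⟦ b x ⟧ ; δ = ∑[ x ∈ xs ] ⟦ d x ⟧ in
              ∑[ x ∈ xs ] h ⟦ b x ⟧ ⟦ d x ⟧ ≡ β * h 1 0 + δ * h 0 1 + (length xs ∸ β ∸ δ) * h 0 0
∑-partition {A} xs b d h disjoint = begin
  ∑[ x ∈ xs ] h ⟦ b x ⟧ ⟦ d x ⟧
    ≡⟨ ∑-cong xs (λ {x} _ → pointwise x) ⟩
  ∑[ x ∈ xs ] (⟦ b x ⟧ * h 1 0 + ⟦ d x ⟧ * h 0 1 + ⟦ ν x ⟧ * h 0 0)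
    ≡⟨ ∑-distrib-+ xs _ _ ⟩
  ∑[ x ∈ xs ] (⟦ b x ⟧ * h 1 0 + ⟦ d x ⟧ * h 0 1) + ∑[ x ∈ xs ] (⟦ ν x ⟧ * h 0 0)
    ≡⟨ cong₂ _+_ (∑-distrib-+ xs _ _) (∑-*ʳ xs _ _) ⟩
  ∑[ x ∈ xs ] (⟦ b x ⟧ * h 1 0) + ∑[ x ∈ xs ] (⟦ d x ⟧ * h 0 1) + ∑[ x ∈ xs ] ⟦ ν x ⟧ * h 0 0
    ≡⟨ cong₂ _+_ (cong₂ _+_ (∑-*ʳ xs _ _) (∑-*ʳ xs _ _)) (cong (_* h 0 0) neither-count) ⟩
  β * h 1 0 + δ * h 0 1 + (length xs ∸ β ∸ δ) * h 0 0 ∎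
  where
  open ≡-Reasoning
  β = ∑[ x ∈ xs ] ⟦ b x ⟧
  δ = ∑[ x ∈ xs ] ⟦ d x ⟧
  ν : A → Bool
  ν x = not (b x ∨ d x)
  pointwise : ∀ x → h ⟦ b x ⟧ ⟦ d x ⟧ ≡ ⟦ b x ⟧ * h 1 0 + ⟦ d x ⟧ * h 0 1 + ⟦ ν x ⟧ * h 0 0
  pointwise x with b x | d x | disjoint x
  ... | true | false | _ = sym (trans (+-identityʳ _) (trans (+-identityʳ _) (*-identityˡ _)))
  ... | false | true | _ = sym (trans (+-identityʳ _) (*-identityˡ _))
  ... | false | false | _ = sym (*-identityˡ _)
  one-each : ∀ x → ⟦ b x ⟧ + ⟦ d x ⟧ + ⟦ ν x ⟧ ≡ 1
  one-each x with b x | d x | disjoint x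
  ... | true | false | _ = refl
  ... | false | true | _ = refl
  ... | false | false | _ = refl
  counts : β + δ + ∑[ x ∈ xs ] ⟦ ν x ⟧ ≡ length xs
  counts = begin
    β + δ + ∑[ x ∈ xs ] ⟦ ν x ⟧
      ≡⟨ cong (_+ ∑ xs (⟦_⟧ ∘ ν)) (∑-distrib-+ xs (⟦_⟧ ∘ b) (⟦_⟧ ∘ d)) ⟨
    ∑[ x ∈ xs ] (⟦ b x ⟧ + ⟦ d x ⟧) + ∑[ x ∈ xs ] ⟦ ν x ⟧ ≡⟨ ∑-distrib-+ xs _ _ ⟨
    ∑[ x ∈ xs ] (⟦ b x ⟧ + ⟦ d x ⟧ + ⟦ ν x ⟧)       ≡⟨ ∑-cong xs (λ {x} _ → one-each x) ⟩
    ∑[ _ ∈ xs ] 1                                 ≡⟨ ∑-const xs 1 ⟩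
    length xs * 1                                 ≡⟨ *-identityʳ _ ⟩
    length xs                                     ∎
  neither-count : ∑[ x ∈ xs ] ⟦ ν x ⟧ ≡ length xs ∸ β ∸ δ
  neither-count = begin
    ∑[ x ∈ xs ] ⟦ ν x ⟧                    ≡⟨ m+n∸m≡n (β + δ) _ ⟨
    β + δ + ∑[ x ∈ xs ] ⟦ ν x ⟧ ∸ (β + δ)  ≡⟨ cong (_∸ (β + δ)) counts ⟩
    length xs ∸ (β + δ)                    ≡⟨ ∸-+-assoc (length xs) β δ ⟨
    length xs ∸ β ∸ δ                      ∎

↭-unique : {xs ys : List A} → Unique xs → Unique ys →
           (∀ {z} → z ∈ xs → z ∈ ys) → (∀ {z} → z ∈ ys → z ∈ xs) → xs ↭ ys
↭-unique xs! ys! to from = ∼bag⇒↭ (unique∧set⇒bag xs! ys! (mk⇔ to from))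

∑-↭ : {xs ys : List A} → xs ↭ ys → (f : A → ℕ) → ∑ xs f ≡ ∑ ys f
∑-↭ xs↭ys f = sum-↭ (↭.map⁺ f xs↭ys)

∑-allFin-punchIn : ∀ {n} (p : Fin (suc n)) (G : Fin (suc n) → ℕ) →
                   ∑ (allFin (suc n)) G ≡ G p + ∑[ z ∈ allFin n ] G (punchIn p z)
∑-allFin-punchIn {n} p G = begin
  ∑ (allFin (suc n)) G                  ≡⟨ ∑-↭ allFin↭ G ⟩
  G p + ∑ (map (punchIn p) (allFin n)) G ≡⟨ cong (G p +_) (∑-map (punchIn p) (allFin n) G) ⟩
  G p + ∑[ z ∈ allFin n ] G (punchIn p z) ∎
  where
  open ≡-Reasoning
  p∉ : ¬ p ∈ map (punchIn p) (allFin n)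
  p∉ p∈ = let (z , _ , p≡) = ∈-map⁻ (punchIn p) p∈ in punchInᵢ≢i p z (sym p≡)
  split : ∀ y → y ∈ p ∷ map (punchIn p) (allFin n)
  split y with y ≟ p
  ... | yes refl = here refl
  ... | no y≢p = there (subst (_∈ _) (punchIn-punchOut (y≢p ∘ sym)) (∈-map⁺ (punchIn p) (∈-allFin _)))
  allFin↭ : allFin (suc n) ↭ p ∷ map (punchIn p) (allFin n)
  allFin↭ = ↭-unique (Unique.allFin⁺ (suc n))
                     (¬Any⇒All¬ _ p∉ ∷ Unique.map⁺ (punchIn-injective p _ _) (Unique.allFin⁺ n))
                     (λ {y} _ → split y) (λ {y} _ → ∈-allFin y)

unique-concatMap : (g : A → List B) {xs : List A} → Unique xs → (∀ {x} → x ∈ xs → Unique (g x)) →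
                   (∀ {x y z} → x ∈ xs → y ∈ xs → z ∈ g x → z ∈ g y → x ≡ y) →
                   Unique (concatMap g xs)
unique-concatMap g [] _ _ = []
unique-concatMap g {x ∷ xs} (x∉xs ∷ xs!) g! disjoint =
  Unique.++⁺ (g! (here refl))
             (unique-concatMap g xs! (g! ∘ there) λ x∈ y∈ → disjoint (there x∈) (there y∈))
             λ (z∈gx , z∈rest) →
               let (y , y∈xs , z∈gy) = find (∈-concatMap⁻ g {xs = xs} z∈rest)
               in Unique.Unique[x∷xs]⇒x∉xs (x∉xs ∷ xs!)
                    (subst (_∈ xs) (sym (disjoint (here refl) (there y∈xs) z∈gx z∈gy)) y∈xs)

allVecs-complete : ∀ n m (v : Vec (Fin n) m) → v ∈ allVecs n m
allVecs-complete n zero [] = here refl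
allVecs-complete n (suc m) (x ∷ v) =
  ∈-concatMap⁺ _ {xs = allFin n}
    (Any.map (λ { refl → ∈-map⁺ (x ∷_) (allVecs-complete n m v) }) (∈-allFin x))

allVecs-unique : ∀ n m → Unique (allVecs n m)
allVecs-unique n zero = [] ∷ []
allVecs-unique n (suc m) =
  unique-concatMap _ (Unique.allFin⁺ n)
    (λ _ → Unique.map⁺ Vecₚ.∷-injectiveʳ (allVecs-unique n m))
    λ _ _ z∈ z∈′ → let (_ , _ , e) = ∈-map⁻ _ z∈ ; (_ , _ , e′) = ∈-map⁻ _ z∈′
                   in Vecₚ.∷-injectiveˡ (trans (sym e) e′)

Sym-unique : ∀ n → Unique (Sym n)
Sym-unique n = Unique.filter⁺ isPerm? (allVecs-unique n n)

∈-Sym⁺ : ∀ {n} {π : Vec (Fin n) n} → IsPerm π → π ∈ Sym n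
∈-Sym⁺ {n} {π} = ∈-filter⁺ isPerm? (allVecs-complete n n π)

∈-Sym⁻ : ∀ {n} {π : Vec (Fin n) n} → π ∈ Sym n → IsPerm π
∈-Sym⁻ {n} π∈ = proj₂ (∈-filter⁻ isPerm? {xs = allVecs n n} π∈)

lookup-extensionality : ∀ {m} {u v : Vec A m} → (∀ i → lookup u i ≡ lookup v i) → u ≡ v
lookup-extensionality {u = u} {v} u≗v =
  trans (sym (Vecₚ.tabulate∘lookup u)) (trans (Vecₚ.tabulate-cong u≗v) (Vecₚ.tabulate∘lookup v))

-- Cycles of an injective endofunction of Fin n

least : ∀ {ℓ} {P : Pred ℕ ℓ} → Decidable P → ℕ → ℕ
least P? zero = zero
least P? (suc b) with P? 0
... | yes _ = 0
... | no _ = suc (least (P? ∘ suc) b)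

least-spec : ∀ {ℓ} {P : Pred ℕ ℓ} (P? : Decidable P) b {w} → w < b → P w →
             P (least P? b) × (∀ {m} → m < least P? b → ¬ P m)
least-spec P? (suc b) w<b Pw with P? 0
... | yes P0 = P0 , λ ()
least-spec P? (suc b) {zero} w<b Pw | no ¬P0 = contradiction Pw ¬P0
least-spec P? (suc b) {suc w} w<b Pw | no ¬P0 =
  let (P-least , below) = least-spec (P? ∘ suc) b (s<s⁻¹ w<b) Pw
  in P-least , λ { {zero} _ → ¬P0 ; {suc m} m< → below (s<s⁻¹ m<) }

<⇒∃+suc : ∀ {m n} → m < n → ∃ λ d → m + suc d ≡ n
<⇒∃+suc {m} m<n = let (d , e) = m≤n⇒∃[o]m+o≡n m<n in d , trans (+-suc m d) e

module _ {n : ℕ} where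
  open import Function.Endo.Propositional (Fin n) public using (_^_; ^-homo)

module _ {n : ℕ} (f : Fin n → Fin n) where
  open import Data.List.Membership.DecPropositional (_≟_ {n}) using (_∈?_)

  ^-+ : ∀ m k x → (f ^ (m + k)) x ≡ (f ^ m) ((f ^ k) x)
  ^-+ m k = cong-app (^-homo f m k)

  ^-*-fixed : ∀ {a x} → (f ^ a) x ≡ x → ∀ q → (f ^ (q * a)) x ≡ x
  ^-*-fixed e zero = refl
  ^-*-fixed {a} {x} e (suc q) = trans (^-+ a (q * a) x) (trans (cong (f ^ a) (^-*-fixed e q)) e)

  ^-injective : Injective _≡_ _≡_ f → ∀ m → Injective _≡_ _≡_ (f ^ m)
  ^-injective inj zero e = e
  ^-injective inj (suc m) e = ^-injective inj m (inj e)

  -- The least positive period of x, searched for below n + 1; it exists when f is injective,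
  -- otherwise the search may return the junk value n + 1.
  cycleLength : Fin n → ℕ
  cycleLength x = suc (least (λ m → (f ^ suc m) x ≟ x) n)

  orbit : Fin n → List (Fin n)
  orbit x = tabulate {n = cycleLength x} λ m → (f ^ toℕ m) x

  InOrbit : Fin n → Fin n → Set
  InOrbit x y = ∃ λ m → (f ^ m) x ≡ y

  sameCycle : Fin n → Fin n → Bool
  sameCycle x y = does (y ∈? orbit x)

  InOrbit-refl : ∀ x → InOrbit x x
  InOrbit-refl x = 0 , refl

  InOrbit-trans : ∀ {x y z} → InOrbit x y → InOrbit y z → InOrbit x z
  InOrbit-trans {x} (m , refl) (l , refl) = l + m , ^-+ l m x

  module _ (inj : Injective _≡_ _≡_ f) where

    returns-within-n : ∀ x → ∃ λ d → d < n × (f ^ suc d) x ≡ x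
    returns-within-n x with pigeonhole (n<1+n n) (λ (m : Fin (suc n)) → (f ^ toℕ m) x)
    ... | i , j , i<j , fⁱx≡fʲx with <⇒∃+suc i<j
    ...   | d , i+d+1≡j =
      d , <-≤-trans (subst (d <_) i+d+1≡j (<-≤-trans (n<1+n d) (m≤n+m (suc d) (toℕ i))))
                    (s≤s⁻¹ (toℕ<n j))
        , ^-injective inj (toℕ i) (trans (sym (^-+ (toℕ i) (suc d) x))
                                  (trans (cong (λ m → (f ^ m) x) i+d+1≡j) (sym fⁱx≡fʲx)))

    private
      cycleLength-spec : ∀ x → (f ^ cycleLength x) x ≡ x ×
                               (∀ {m} → m < pred (cycleLength x) → (f ^ suc m) x ≢ x)
      cycleLength-spec x = let (d , d<n , returns) = returns-within-n x
                           in least-spec (λ m → (f ^ suc m) x ≟ x) n d<n returns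

    ^-cycleLength : ∀ x → (f ^ cycleLength x) x ≡ x
    ^-cycleLength x = proj₁ (cycleLength-spec x)

    cycleLength-minimal : ∀ {x m} → 0 < m → m < cycleLength x → (f ^ m) x ≢ x
    cycleLength-minimal {x} {suc m} _ m<c = proj₂ (cycleLength-spec x) (s<s⁻¹ m<c)

    ^-%-cycleLength : ∀ k x → (f ^ k) x ≡ (f ^ (k % cycleLength x)) x
    ^-%-cycleLength k x = let c = cycleLength x in begin
      (f ^ k) x                           ≡⟨ cong (λ m → (f ^ m) x) (m≡m%n+[m/n]*n k c) ⟩
      (f ^ (k % c + (k / c) * c)) x       ≡⟨ ^-+ (k % c) _ x ⟩
      (f ^ (k % c)) ((f ^ ((k / c) * c)) x) ≡⟨ cong (f ^ (k % c)) (^-*-fixed (^-cycleLength x) (k / c)) ⟩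
      (f ^ (k % c)) x                     ∎
      where open ≡-Reasoning

    fixed⇔cycleLength∣ : ∀ k x → (f ^ k) x ≡ x ⇔ cycleLength x ∣ k
    fixed⇔cycleLength∣ k x = mk⇔ to from
      where
      c = cycleLength x
      to : (f ^ k) x ≡ x → c ∣ k
      to fixed with k % c in k%c≡r
      ... | zero = m%n≡0⇒n∣m k c k%c≡r
      ... | suc r = contradiction
        (trans (cong (λ m → (f ^ m) x) (sym k%c≡r)) (trans (sym (^-%-cycleLength k x)) fixed))
        (cycleLength-minimal z<s (subst (_< c) k%c≡r (m%n<n k c)))
      from : c ∣ k → (f ^ k) x ≡ x
      from (divides q refl) = ^-*-fixed (^-cycleLength x) q

    ^-≢-below : ∀ {x a b} → a < b → b < cycleLength x → (f ^ a) x ≢ (f ^ b) x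
    ^-≢-below {x} {a} a<b b<c fᵃx≡fᵇx with <⇒∃+suc a<b
    ... | d , refl = cycleLength-minimal z<s (≤-<-trans (m≤n+m (suc d) a) b<c)
                       (^-injective inj a (trans (sym (^-+ a (suc d) x)) (sym fᵃx≡fᵇx)))

    ^-distinct : ∀ {x m m′} → m < cycleLength x → m′ < cycleLength x → (f ^ m) x ≡ (f ^ m′) x → m ≡ m′
    ^-distinct {m = m} {m′} m<c m′<c e with <-cmp m m′
    ... | tri< m<m′ _ _ = contradiction e (^-≢-below m<m′ m′<c)
    ... | tri≈ _ m≡m′ _ = m≡m′
    ... | tri> _ _ m′<m = contradiction (sym e) (^-≢-below m′<m m<c)

    ∈-orbit⇔InOrbit : ∀ {x y} → y ∈ orbit x ⇔ InOrbit x y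
    ∈-orbit⇔InOrbit {x} = mk⇔ to from
      where
      to : ∀ {y} → y ∈ orbit x → InOrbit x y
      to y∈ = let (m , y≡fᵐx) = ∈-tabulate⁻ {f = λ m → (f ^ toℕ m) x} y∈ in toℕ m , sym y≡fᵐx
      from : ∀ {y} → InOrbit x y → y ∈ orbit x
      from (m , refl) = subst (_∈ orbit x) reduce (∈-tabulate⁺ {f = λ m → (f ^ toℕ m) x} (fromℕ< r<c))
        where
        r<c = m%n<n m (cycleLength x)
        reduce : (f ^ toℕ (fromℕ< r<c)) x ≡ (f ^ m) x
        reduce = trans (cong (λ k → (f ^ k) x) (toℕ-fromℕ< r<c)) (sym (^-%-cycleLength m x))

    inOrbit? : ∀ x y → Dec (InOrbit x y)
    inOrbit? x y = Dec.map ∈-orbit⇔InOrbit (y ∈? orbit x)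

    orbit-unique : ∀ x → Unique (orbit x)
    orbit-unique x = Unique.tabulate⁺ {f = λ m → (f ^ toℕ m) x}
                       λ {i j} e → toℕ-injective (^-distinct (toℕ<n i) (toℕ<n j) e)

    cycleLength-orbitSize : ∀ x → ∑[ z ∈ allFin n ] ⟦ sameCycle x z ⟧ ≡ cycleLength x
    cycleLength-orbitSize x = begin
      ∑[ z ∈ allFin n ] ⟦ sameCycle x z ⟧     ≡⟨ length-filter (_∈? orbit x) (allFin n) ⟨
      length (filter (_∈? orbit x) (allFin n)) ≡⟨ ↭-length filter↭orbit ⟩
      length (orbit x)                         ≡⟨ length-tabulate (λ m → (f ^ toℕ m) x) ⟩
      cycleLength x                            ∎
      where
      open ≡-Reasoning
      filter↭orbit : filter (_∈? orbit x) (allFin n) ↭ orbit x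
      filter↭orbit = ↭-unique (Unique.filter⁺ (_∈? orbit x) (Unique.allFin⁺ n)) (orbit-unique x)
                              (proj₂ ∘ ∈-filter⁻ (_∈? orbit x) {xs = allFin n})
                              (λ {z} → ∈-filter⁺ (_∈? orbit x) (∈-allFin z))

    InOrbit-sym : ∀ {x y} → InOrbit x y → InOrbit y x
    InOrbit-sym {x} (m , refl) = m * c′ , (begin
      (f ^ (m * c′)) ((f ^ m) x) ≡⟨ ^-+ (m * c′) m x ⟨
      (f ^ (m * c′ + m)) x        ≡⟨ cong (λ k → (f ^ k) x) (trans (+-comm (m * c′) m) (sym (*-suc m c′))) ⟩
      (f ^ (m * suc c′)) x        ≡⟨ ^-*-fixed (^-cycleLength x) m ⟩
      x                           ∎)
      where
      open ≡-Reasoning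
      c′ = pred (cycleLength x)

    InOrbit-orbit : ∀ {x y} → InOrbit x y → ∀ z → InOrbit x z ⇔ InOrbit y z
    InOrbit-orbit x~y z = mk⇔ (InOrbit-trans (InOrbit-sym x~y)) (InOrbit-trans x~y)

    sameCycle-orbit : ∀ {x y} → InOrbit x y → ∀ z → sameCycle x z ≡ sameCycle y z
    sameCycle-orbit {x} {y} x~y z = does-⇔ (InOrbit-orbit x~y z) (inOrbit? x z) (inOrbit? y z)

    cycleLength-orbit : ∀ {x y} → InOrbit x y → cycleLength x ≡ cycleLength y
    cycleLength-orbit {x} {y} x~y = begin
      cycleLength x                       ≡⟨ cycleLength-orbitSize x ⟨
      ∑[ z ∈ allFin n ] ⟦ sameCycle x z ⟧ ≡⟨ ∑-cong (allFin n) (λ {z} _ → cong ⟦_⟧ (sameCycle-orbit x~y z)) ⟩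
      ∑[ z ∈ allFin n ] ⟦ sameCycle y z ⟧ ≡⟨ cycleLength-orbitSize y ⟩
      cycleLength y                       ∎
      where open ≡-Reasoning

    sameCycle⇒InOrbit : ∀ {x y} → sameCycle x y ≡ true → InOrbit x y
    sameCycle⇒InOrbit {x} {y} = from-does (inOrbit? x y)
      where
      from-does : (d : Dec (InOrbit x y)) → does d ≡ true → InOrbit x y
      from-does (yes x~y) _ = x~y
      from-does (no _) ()

    sameCycle-disjoint : ∀ {x y} → sameCycle x y ≡ false → ∀ z → sameCycle x z ∧ sameCycle y z ≡ false
    sameCycle-disjoint {x} {y} x≁y z with sameCycle x z in x~z | sameCycle y z in y~z
    ... | true | true = contradiction (trans (sym (dec-true (inOrbit? x y) x~y)) x≁y) λ ()
      where x~y = InOrbit-trans (sameCycle⇒InOrbit x~z) (InOrbit-sym (sameCycle⇒InOrbit y~z))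
    ... | true | false = refl
    ... | false | _ = refl

    ∑-orbits : ∀ {x y} → sameCycle x y ≡ false → (h : ℕ → ℕ → ℕ) →
               let a = cycleLength x ; b = cycleLength y in
               ∑[ z ∈ allFin n ] h ⟦ sameCycle x z ⟧ ⟦ sameCycle y z ⟧
                 ≡ a * h 1 0 + b * h 0 1 + (n ∸ a ∸ b) * h 0 0
    ∑-orbits {x} {y} x≁y h = begin
      ∑[ z ∈ allFin n ] h ⟦ sameCycle x z ⟧ ⟦ sameCycle y z ⟧
        ≡⟨ ∑-partition (allFin n) (sameCycle x) (sameCycle y) h (sameCycle-disjoint x≁y) ⟩
      size x * h 1 0 + size y * h 0 1 + (length (allFin n) ∸ size x ∸ size y) * h 0 0
        ≡⟨ cong₂ (λ a b → a * h 1 0 + b * h 0 1 + (length (allFin n) ∸ a ∸ b) * h 0 0)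
                 (cycleLength-orbitSize x) (cycleLength-orbitSize y) ⟩
      a * h 1 0 + b * h 0 1 + (length (allFin n) ∸ a ∸ b) * h 0 0
        ≡⟨ cong (λ m → a * h 1 0 + b * h 0 1 + (m ∸ a ∸ b) * h 0 0) (length-tabulate {n = n} id) ⟩
      a * h 1 0 + b * h 0 1 + (n ∸ a ∸ b) * h 0 0 ∎
      where
      open ≡-Reasoning
      size : Fin n → ℕ
      size w = ∑[ z ∈ allFin n ] ⟦ sameCycle w z ⟧
      a = cycleLength x
      b = cycleLength y

    ∑-orbit : ∀ x (h : ℕ → ℕ) →
              ∑[ z ∈ allFin n ] h ⟦ sameCycle x z ⟧ ≡ cycleLength x * h 1 + (n ∸ cycleLength x) * h 0
    ∑-orbit x h = begin
      ∑[ z ∈ allFin n ] h ⟦ sameCycle x z ⟧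
        ≡⟨ ∑-partition (allFin n) (sameCycle x) (λ _ → false) (λ u _ → h u) (λ z → ∧-zeroʳ (sameCycle x z)) ⟩
      size * h 1 + none * h 0 + (length (allFin n) ∸ size ∸ none) * h 0
        ≡⟨ cong₂ (λ a m → a * h 1 + none * h 0 + (m ∸ a ∸ none) * h 0)
                 (cycleLength-orbitSize x) (length-tabulate {n = n} id) ⟩
      a * h 1 + none * h 0 + (n ∸ a ∸ none) * h 0
        ≡⟨ cong (λ m → a * h 1 + m * h 0 + (n ∸ a ∸ m) * h 0) (∑-zero (allFin n)) ⟩
      a * h 1 + 0 + (n ∸ a) * h 0
        ≡⟨ cong (_+ (n ∸ a) * h 0) (+-identityʳ _) ⟩
      a * h 1 + (n ∸ a) * h 0 ∎
      where
      open ≡-Reasoning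
      size = ∑[ z ∈ allFin n ] ⟦ sameCycle x z ⟧
      none = ∑[ _ ∈ allFin n ] 0
      a = cycleLength x

-- Inserting a point into a permutation

module _ {n : ℕ} (p : Fin (suc n)) where

  -- g arises from f by inserting the new point p right after c on its cycle (as a new fixed
  -- point when c = p), the old points being relabelled by punchIn p.
  record Insertion (c : Fin (suc n)) (f : Fin n → Fin n) (g : Fin (suc n) → Fin (suc n)) : Set where
    field
      at-c : g c ≡ p
      at-p : ∀ {c′} → punchIn p c′ ≡ c → g p ≡ punchIn p (f c′)
      elsewhere : ∀ {x} → punchIn p x ≢ c → g (punchIn p x) ≡ punchIn p (f x)

  data Position (c y : Fin (suc n)) : Set where
    is-c : y ≡ c → Position c y
    is-p : ∀ {c′} → y ≡ p → punchIn p c′ ≡ c → Position c y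
    is-old : ∀ {x} → y ≡ punchIn p x → punchIn p x ≢ c → Position c y

  position : ∀ c y → Position c y
  position c y with y ≟ c | y ≟ p
  ... | yes y≡c | _ = is-c y≡c
  ... | no y≢c | yes refl = is-p refl (punchIn-punchOut y≢c)
  ... | no y≢c | no y≢p = is-old (sym (punchIn-punchOut (y≢p ∘ sym)))
                                 (y≢c ∘ trans (sym (punchIn-punchOut (y≢p ∘ sym))))

  insert : (Fin n → Fin n) → Fin (suc n) → Fin (suc n) → Fin (suc n)
  insert f c y with position c y
  ... | is-c _ = p
  ... | is-p {c′} _ _ = punchIn p (f c′)
  ... | is-old {x} _ _ = punchIn p (f x)

  insert-Insertion : ∀ f c → Insertion c f (insert f c)
  insert-Insertion f c = record { at-c = at-c ; at-p = at-p ; elsewhere = elsewhere }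
    where
    at-c : insert f c c ≡ p
    at-c with position c c
    ... | is-c _ = refl
    ... | is-p refl c′↦p = contradiction c′↦p (punchInᵢ≢i p _)
    ... | is-old c≡x↑ x↑≢c = contradiction (sym c≡x↑) x↑≢c
    at-p : ∀ {c′} → punchIn p c′ ≡ c → insert f c p ≡ punchIn p (f c′)
    at-p c′↦c with position c p
    ... | is-c refl = contradiction c′↦c (punchInᵢ≢i p _)
    ... | is-p _ c″↦c = cong (punchIn p ∘ f) (punchIn-injective p _ _ (trans c″↦c (sym c′↦c)))
    ... | is-old p≡x↑ _ = contradiction (sym p≡x↑) (punchInᵢ≢i p _)
    elsewhere : ∀ {x} → punchIn p x ≢ c → insert f c (punchIn p x) ≡ punchIn p (f x)
    elsewhere {x} x↑≢c with position c (punchIn p x)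
    ... | is-c x↑≡c = contradiction x↑≡c x↑≢c
    ... | is-p x↑≡p _ = contradiction x↑≡p (punchInᵢ≢i p _)
    ... | is-old x↑≡x′↑ _ = cong (punchIn p ∘ f) (punchIn-injective p _ _ (sym x↑≡x′↑))

  Insertion-resp : ∀ {c f f′ g g′} → (∀ x → f x ≡ f′ x) → (∀ y → g y ≡ g′ y) →
                   Insertion c f g → Insertion c f′ g′
  Insertion-resp {f = f} {f′} {g} {g′} f≗f′ g≗g′ ins = record
    { at-c = trans (sym (g≗g′ _)) at-c
    ; at-p = λ c′↦c → trans (sym (g≗g′ p)) (trans (at-p c′↦c) (cong (punchIn p) (f≗f′ _)))
    ; elsewhere = λ x↑≢c → trans (sym (g≗g′ _)) (trans (elsewhere x↑≢c) (cong (punchIn p) (f≗f′ _)))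
    }
    where open Insertion ins

  module _ {c f g} (ins : Insertion c f g) where
    open Insertion ins

    Insertion-unique : ∀ {h} → Insertion c f h → ∀ y → g y ≡ h y
    Insertion-unique ins′ y with position c y
    ... | is-c refl = trans at-c (sym (Insertion.at-c ins′))
    ... | is-p refl c′↦c = trans (at-p c′↦c) (sym (Insertion.at-p ins′ c′↦c))
    ... | is-old refl x↑≢c = trans (elsewhere x↑≢c) (sym (Insertion.elsewhere ins′ x↑≢c))

    Insertion-determines-f : ∀ {f′} → Insertion c f′ g → ∀ x → f x ≡ f′ x
    Insertion-determines-f ins′ x with punchIn p x ≟ c
    ... | yes x↑≡c = punchIn-injective p _ _ (trans (sym (at-p x↑≡c)) (Insertion.at-p ins′ x↑≡c))
    ... | no x↑≢c = punchIn-injective p _ _ (trans (sym (elsewhere x↑≢c)) (Insertion.elsewhere ins′ x↑≢c))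

    g≡p⇒c : ∀ {y} → g y ≡ p → y ≡ c
    g≡p⇒c {y} gy≡p with position c y
    ... | is-c y≡c = y≡c
    ... | is-p refl c′↦c = contradiction (trans (sym (at-p c′↦c)) gy≡p) (punchInᵢ≢i p _)
    ... | is-old refl x↑≢c = contradiction (trans (sym (elsewhere x↑≢c)) gy≡p) (punchInᵢ≢i p _)

    g-old≢g-p : Injective _≡_ _≡_ f → ∀ {c′ x} → punchIn p c′ ≡ c → punchIn p x ≢ c → g (punchIn p x) ≢ g p
    g-old≢g-p inj c′↦c x↑≢c gx↑≡gp = x↑≢c (trans (cong (punchIn p)
      (inj (punchIn-injective p _ _ (trans (sym (elsewhere x↑≢c)) (trans gx↑≡gp (at-p c′↦c)))))) c′↦c)

    Insertion-injective : Injective _≡_ _≡_ f → Injective _≡_ _≡_ g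
    Insertion-injective inj {y} {y′} gy≡gy′ with position c y | position c y′
    ... | is-c refl | _ = sym (g≡p⇒c (trans (sym gy≡gy′) at-c))
    ... | _ | is-c refl = g≡p⇒c (trans gy≡gy′ at-c)
    ... | is-p y≡p _ | is-p y′≡p _ = trans y≡p (sym y′≡p)
    ... | is-old refl x↑≢c | is-old refl x′↑≢c =
      cong (punchIn p) (inj (punchIn-injective p _ _
        (trans (sym (elsewhere x↑≢c)) (trans gy≡gy′ (elsewhere x′↑≢c)))))
    ... | is-p refl c′↦c | is-old refl x↑≢c = contradiction (sym gy≡gy′) (g-old≢g-p inj c′↦c x↑≢c)
    ... | is-old refl x↑≢c | is-p refl c′↦c = contradiction gy≡gy′ (g-old≢g-p inj c′↦c x↑≢c)

    Insertion-injective⁻ : Injective _≡_ _≡_ g → Injective _≡_ _≡_ f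
    Insertion-injective⁻ ginj {x} {x′} fx≡fx′ with punchIn p x ≟ c | punchIn p x′ ≟ c
    ... | yes x↑≡c | yes x′↑≡c = punchIn-injective p _ _ (trans x↑≡c (sym x′↑≡c))
    ... | yes x↑≡c | no x′↑≢c = contradiction
      (ginj (trans (at-p x↑≡c) (trans (cong (punchIn p) fx≡fx′) (sym (elsewhere x′↑≢c)))))
      (punchInᵢ≢i p x′ ∘ sym)
    ... | no x↑≢c | yes x′↑≡c = contradiction
      (ginj (trans (elsewhere x↑≢c) (trans (cong (punchIn p) fx≡fx′) (sym (at-p x′↑≡c)))))
      (punchInᵢ≢i p x)
    ... | no x↑≢c | no x′↑≢c = punchIn-injective p _ _
      (ginj (trans (elsewhere x↑≢c) (trans (cong (punchIn p) fx≡fx′) (sym (elsewhere x′↑≢c)))))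

    lift-step : ∀ x → InOrbit g (punchIn p x) (punchIn p (f x))
    lift-step x with punchIn p x ≟ c
    ... | yes x↑≡c = 2 , trans (cong g (trans (cong g x↑≡c) at-c)) (at-p x↑≡c)
    ... | no x↑≢c = 1 , elsewhere x↑≢c

    lift : ∀ {x z} → InOrbit f x z → InOrbit g (punchIn p x) (punchIn p z)
    lift (zero , refl) = InOrbit-refl g _
    lift (suc m , refl) = InOrbit-trans g (lift (m , refl)) (lift-step _)

    -- Invariant of the g-orbit of punchIn p x: it visits only lifts of the f-orbit of x, and
    -- visits p only if that orbit passes through c.
    data Lifted (x : Fin n) : Fin (suc n) → Set where
      old : ∀ {z} → InOrbit f x z → Lifted x (punchIn p z)
      new : ∀ {c′} → punchIn p c′ ≡ c → InOrbit f x c′ → Lifted x p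

    Lifted-step : ∀ {x y} → Lifted x y → Lifted x (g y)
    Lifted-step {x} (old {z} x~z) with punchIn p z ≟ c
    ... | yes z↑≡c = subst (Lifted x) (sym (trans (cong g z↑≡c) at-c)) (new z↑≡c x~z)
    ... | no z↑≢c = subst (Lifted x) (sym (elsewhere z↑≢c)) (old (InOrbit-trans f x~z (1 , refl)))
    Lifted-step {x} (new c′↦c x~c′) =
      subst (Lifted x) (sym (at-p c′↦c)) (old (InOrbit-trans f x~c′ (1 , refl)))

    Lifted-orbit : ∀ {x y} → InOrbit g (punchIn p x) y → Lifted x y
    Lifted-orbit {x} (zero , refl) = old (InOrbit-refl f x)
    Lifted-orbit {x} (suc m , refl) = Lifted-step (Lifted-orbit (m , refl))

    InOrbit-insert : ∀ {x z} → InOrbit g (punchIn p x) (punchIn p z) ⇔ InOrbit f x z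
    InOrbit-insert = mk⇔ (λ x↑~z↑ → unlift (Lifted-orbit x↑~z↑) refl) lift
      where
      unlift : ∀ {x y z} → Lifted x y → y ≡ punchIn p z → InOrbit f x z
      unlift (old x~z′) z′↑≡z↑ = subst (InOrbit f _) (punchIn-injective p _ _ z′↑≡z↑) x~z′
      unlift (new _ _) p≡z↑ = contradiction (sym p≡z↑) (punchInᵢ≢i p _)

    InOrbit-insert-p : ∀ {x} → InOrbit g (punchIn p x) p ⇔ (∃ λ c′ → punchIn p c′ ≡ c × InOrbit f x c′)
    InOrbit-insert-p = mk⇔ (λ x↑~p → unlift (Lifted-orbit x↑~p) refl)
                           λ (c′ , c′↦c , x~c′) → InOrbit-trans g (lift x~c′) (1 , trans (cong g c′↦c) at-c)
      where
      unlift : ∀ {x y} → Lifted x y → y ≡ p → ∃ λ c′ → punchIn p c′ ≡ c × InOrbit f x c′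
      unlift (old _) z↑≡p = contradiction z↑≡p (punchInᵢ≢i p _)
      unlift (new c′↦c x~c′) _ = _ , c′↦c , x~c′

    module _ (inj : Injective _≡_ _≡_ f) where
      private
        ginj = Insertion-injective inj

      sameCycle-insert : ∀ x y → sameCycle g (punchIn p x) (punchIn p y) ≡ sameCycle f x y
      sameCycle-insert x y = does-⇔ InOrbit-insert (inOrbit? g ginj _ _) (inOrbit? f inj x y)

      cycleLength-insert : ∀ x → cycleLength g (punchIn p x) ≡ ⟦ sameCycle g (punchIn p x) p ⟧ + cycleLength f x
      cycleLength-insert x = begin
        cycleLength g x↑
          ≡⟨ cycleLength-orbitSize g ginj x↑ ⟨
        ∑[ y ∈ allFin (suc n) ] ⟦ sameCycle g x↑ y ⟧
          ≡⟨ ∑-allFin-punchIn p _ ⟩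
        ⟦ sameCycle g x↑ p ⟧ + ∑[ z ∈ allFin n ] ⟦ sameCycle g x↑ (punchIn p z) ⟧
          ≡⟨ cong (⟦ sameCycle g x↑ p ⟧ +_) lifted-size ⟩
        ⟦ sameCycle g x↑ p ⟧ + cycleLength f x ∎
        where
        open ≡-Reasoning
        x↑ = punchIn p x
        lifted-size : ∑[ z ∈ allFin n ] ⟦ sameCycle g x↑ (punchIn p z) ⟧ ≡ cycleLength f x
        lifted-size = trans (∑-cong (allFin n) λ {z} _ → cong ⟦_⟧ (sameCycle-insert x z))
                            (cycleLength-orbitSize f inj x)

      sameCycle-insert-fixed : c ≡ p → ∀ x → sameCycle g (punchIn p x) p ≡ false
      sameCycle-insert-fixed c≡p x = dec-false (inOrbit? g ginj _ _) λ x↑~p →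
        let (c′ , c′↦c , _) = Equivalence.to InOrbit-insert-p x↑~p in punchInᵢ≢i p c′ (trans c′↦c c≡p)

      sameCycle-insert-after : ∀ {c′} → punchIn p c′ ≡ c → ∀ x → sameCycle g (punchIn p x) p ≡ sameCycle f x c′
      sameCycle-insert-after {c′} c′↦c x = does-⇔ (mk⇔ to from) (inOrbit? g ginj _ _) (inOrbit? f inj x c′)
        where
        from : InOrbit f x c′ → InOrbit g (punchIn p x) p
        from x~c′ = Equivalence.from InOrbit-insert-p (c′ , c′↦c , x~c′)
        to : InOrbit g (punchIn p x) p → InOrbit f x c′
        to x↑~p = let (c″ , c″↦c , x~c″) = Equivalence.to InOrbit-insert-p x↑~p
                  in subst (InOrbit f x) (punchIn-injective p _ _ (trans c″↦c (sym c′↦c))) x~c″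

  module _ {g : Fin (suc n) → Fin (suc n)} (inj : Injective _≡_ _≡_ g) where

    remove : Fin n → Fin n
    remove x with g (punchIn p x) ≟ p
    ... | yes gx↑≡p = punchOut {i = p} {j = g p} λ p≡gp → punchInᵢ≢i p x (inj (trans gx↑≡p p≡gp))
    ... | no gx↑≢p = punchOut (gx↑≢p ∘ sym)

    remove-Insertion : ∀ {c} → g c ≡ p → Insertion c remove g
    remove-Insertion {c} gc≡p = record { at-c = gc≡p ; at-p = at-p ; elsewhere = elsewhere }
      where
      at-p : ∀ {c′} → punchIn p c′ ≡ c → g p ≡ punchIn p (remove c′)
      at-p {c′} c′↦c with g (punchIn p c′) ≟ p
      ... | yes _ = sym (punchIn-punchOut _)
      ... | no gc′↑≢p = contradiction (trans (cong g c′↦c) gc≡p) gc′↑≢p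
      elsewhere : ∀ {x} → punchIn p x ≢ c → g (punchIn p x) ≡ punchIn p (remove x)
      elsewhere {x} x↑≢c with g (punchIn p x) ≟ p
      ... | yes gx↑≡p = contradiction (inj (trans gx↑≡p (sym gc≡p))) x↑≢c
      ... | no _ = sym (punchIn-punchOut _)

  insertᵛ : Vec (Fin n) n → Fin (suc n) → Vec (Fin (suc n)) (suc n)
  insertᵛ π c = Vec.tabulate (insert (lookup π) c)

  insertᵛ-Insertion : ∀ π c → Insertion c (lookup π) (lookup (insertᵛ π c))
  insertᵛ-Insertion π c =
    Insertion-resp (λ _ → refl) (sym ∘ Vecₚ.lookup∘tabulate _) (insert-Insertion (lookup π) c)

  insertᵛ-perm : ∀ {π} c → IsPerm π → IsPerm (insertᵛ π c)
  insertᵛ-perm {π} c perm _ _ = Insertion-injective (insertᵛ-Insertion π c) (perm _ _)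

  insertᵛ-injective : ∀ {π π′ c} → insertᵛ π c ≡ insertᵛ π′ c → π ≡ π′
  insertᵛ-injective {π} {π′} {c} eq = lookup-extensionality
    (Insertion-determines-f (insertᵛ-Insertion π c)
      (subst (Insertion c (lookup π′) ∘ lookup) (sym eq) (insertᵛ-Insertion π′ c)))

  insertᵛ-disjoint : ∀ {π π′ c c′} → IsPerm π′ → insertᵛ π c ≡ insertᵛ π′ c′ → c ≡ c′
  insertᵛ-disjoint {π} {π′} {c} {c′} perm eq = insertᵛ-perm {π′} c′ perm c c′ (begin
    lookup (insertᵛ π′ c′) c  ≡⟨ cong (λ v → lookup v c) eq ⟨
    lookup (insertᵛ π c) c    ≡⟨ Insertion.at-c (insertᵛ-Insertion π c) ⟩
    p                         ≡⟨ Insertion.at-c (insertᵛ-Insertion π′ c′) ⟨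
    lookup (insertᵛ π′ c′) c′ ∎)
    where open ≡-Reasoning

  insertᵛ-surjective : ∀ {π} → IsPerm π → ∃ λ c → ∃ λ π′ → IsPerm π′ × insertᵛ π′ c ≡ π
  insertᵛ-surjective {π} perm = c , π′ , perm′ , lookup-extensionality
    (Insertion-unique (insertᵛ-Insertion π′ c) ins)
    where
    f = lookup π
    inj : Injective _≡_ _≡_ f
    inj = perm _ _
    c = (f ^ pred (cycleLength f p)) p  -- the predecessor of p on its cycle
    π′ = Vec.tabulate (remove inj)
    ins : Insertion c (lookup π′) f
    ins = Insertion-resp (sym ∘ Vecₚ.lookup∘tabulate _) (λ _ → refl)
                         (remove-Insertion inj (^-cycleLength f inj p))
    perm′ : IsPerm π′
    perm′ _ _ = Insertion-injective⁻ ins inj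

  ∑-Sym-suc : (G : Vec (Fin (suc n)) (suc n) → ℕ) →
              ∑ (Sym (suc n)) G ≡ ∑[ c ∈ allFin (suc n) ] ∑[ π ∈ Sym n ] G (insertᵛ π c)
  ∑-Sym-suc G = begin
    ∑ (Sym (suc n)) G                                      ≡⟨ ∑-↭ Sym↭insertions G ⟩
    ∑ (concatMap insertionsAt (allFin (suc n))) G          ≡⟨ ∑-concatMap insertionsAt (allFin (suc n)) G ⟩
    ∑[ c ∈ allFin (suc n) ] ∑ (insertionsAt c) G           ≡⟨ ∑-cong (allFin (suc n)) (λ _ → ∑-map _ (Sym n) G) ⟩
    ∑[ c ∈ allFin (suc n) ] ∑[ π ∈ Sym n ] G (insertᵛ π c) ∎
    where
    open ≡-Reasoning
    insertionsAt : Fin (suc n) → List (Vec (Fin (suc n)) (suc n))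
    insertionsAt c = map (λ π → insertᵛ π c) (Sym n)
    disjoint : ∀ {c c′ v} → v ∈ insertionsAt c → v ∈ insertionsAt c′ → c ≡ c′
    disjoint {c} {c′} v∈ v∈′ =
      let (π , _ , v≡) = ∈-map⁻ (λ π → insertᵛ π c) v∈ ; (π′ , π′∈ , v≡′) = ∈-map⁻ (λ π → insertᵛ π c′) v∈′
      in insertᵛ-disjoint {π} {π′} (∈-Sym⁻ π′∈) (trans (sym v≡) v≡′)
    to : ∀ {v} → v ∈ Sym (suc n) → v ∈ concatMap insertionsAt (allFin (suc n))
    to v∈ = let (c , π′ , perm′ , π′↦v) = insertᵛ-surjective (∈-Sym⁻ v∈) in
      subst (_∈ concatMap insertionsAt (allFin (suc n))) π′↦v (∈-concatMap⁺ insertionsAt {xs = allFin (suc n)}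
        (Any.map (λ { refl → ∈-map⁺ (λ π → insertᵛ π c) (∈-Sym⁺ {π = π′} perm′) }) (∈-allFin c)))
    from : ∀ {v} → v ∈ concatMap insertionsAt (allFin (suc n)) → v ∈ Sym (suc n)
    from v∈ with find (∈-concatMap⁻ insertionsAt {xs = allFin (suc n)} v∈)
    ... | c , _ , v∈c with ∈-map⁻ (λ π → insertᵛ π c) v∈c
    ...   | π , π∈ , refl = ∈-Sym⁺ {π = insertᵛ π c} (insertᵛ-perm {π} c (∈-Sym⁻ π∈))
    Sym↭insertions : Sym (suc n) ↭ concatMap insertionsAt (allFin (suc n))
    Sym↭insertions = ↭-unique (Sym-unique (suc n))
      (unique-concatMap insertionsAt (Unique.allFin⁺ (suc n))
        (λ {c} _ → Unique.map⁺ (insertᵛ-injective {c = c}) (Sym-unique n)) (λ _ _ → disjoint))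
      to from


-- Cycle statistics of two points

Statistic : Set
Statistic = ℕ → ℕ → Bool → ℕ

observe : ∀ {n} → Statistic → (Fin n → Fin n) → Fin n → Fin n → ℕ
observe Φ f i j = Φ (cycleLength f i) (cycleLength f j) (sameCycle f i j)

total : Statistic → ∀ n → Fin n → Fin n → ℕ
total Φ n i j = ∑[ π ∈ Sym n ] observe Φ (lookup π) i j

-- Inserting the new point after a point on the cycle of i (a choices) or of j (b choices)
-- lengthens that cycle; inserting it after itself or after any other point (n + 1 - a - b
-- choices, or n + 1 - a when the cycles coincide) changes neither length.
insertionSum : ℕ → Statistic → Statistic
insertionSum n Φ a b true = suc (n ∸ a) * Φ a b true + a * Φ (suc a) (suc b) true
insertionSum n Φ a b false =
  suc (n ∸ a ∸ b) * Φ a b false + a * Φ (suc a) b false + b * Φ a (suc b) false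

module _ {n : ℕ} (p : Fin (suc n)) (Φ : Statistic) {f : Fin n → Fin n} (inj : Injective _≡_ _≡_ f) where

  observe-insert : ∀ {c g} → Insertion p c f g → ∀ i j →
                   observe Φ g (punchIn p i) (punchIn p j)
                     ≡ Φ (⟦ sameCycle g (punchIn p i) p ⟧ + cycleLength f i)
                         (⟦ sameCycle g (punchIn p j) p ⟧ + cycleLength f j) (sameCycle f i j)
  observe-insert {g = g} ins i j =
    trans (cong₂ (λ a b → Φ a b (sameCycle g (punchIn p i) (punchIn p j)))
                 (cycleLength-insert p ins inj i) (cycleLength-insert p ins inj j))
          (cong (Φ _ _) (sameCycle-insert p ins inj i j))

  insertionSum-orbits : ∀ i j → let a = cycleLength f i ; b = cycleLength f j ; s = sameCycle f i j in
                        Φ a b s + ∑[ z ∈ allFin n ] Φ (⟦ sameCycle f i z ⟧ + a) (⟦ sameCycle f j z ⟧ + b) s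
                          ≡ insertionSum n Φ a b s
  insertionSum-orbits i j = by-cases (sameCycle f i j) refl
    where
    open ≡-Reasoning
    a = cycleLength f i
    b = cycleLength f j
    by-cases : ∀ t → sameCycle f i j ≡ t →
               Φ a b t + ∑[ z ∈ allFin n ] Φ (⟦ sameCycle f i z ⟧ + a) (⟦ sameCycle f j z ⟧ + b) t
                 ≡ insertionSum n Φ a b t
    by-cases true i~j = begin
      Φ a b true + ∑[ z ∈ allFin n ] Φ (⟦ sameCycle f i z ⟧ + a) (⟦ sameCycle f j z ⟧ + b) true
        ≡⟨ cong (Φ a b true +_) (∑-cong (allFin n) λ {z} _ →
             cong (λ u → Φ (⟦ sameCycle f i z ⟧ + a) (⟦ u ⟧ + b) true) (sym (same-orbit z))) ⟩
      Φ a b true + ∑[ z ∈ allFin n ] Φ (⟦ sameCycle f i z ⟧ + a) (⟦ sameCycle f i z ⟧ + b) true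
        ≡⟨ cong (Φ a b true +_) (∑-orbit f inj i λ u → Φ (u + a) (u + b) true) ⟩
      Φ a b true + (a * Φ (suc a) (suc b) true + (n ∸ a) * Φ a b true)
        ≡⟨ rearrange (Φ a b true) (Φ (suc a) (suc b) true) (n ∸ a) a ⟩
      insertionSum n Φ a b true ∎
      where
      same-orbit = sameCycle-orbit f inj (sameCycle⇒InOrbit f inj i~j)
      rearrange : ∀ u v w k → u + (k * v + w * u) ≡ suc w * u + k * v
      rearrange = solve-∀
    by-cases false i≁j = begin
      Φ a b false + ∑[ z ∈ allFin n ] Φ (⟦ sameCycle f i z ⟧ + a) (⟦ sameCycle f j z ⟧ + b) false
        ≡⟨ cong (Φ a b false +_) (∑-orbits f inj i≁j λ u v → Φ (u + a) (v + b) false) ⟩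
      Φ a b false + (a * Φ (suc a) b false + b * Φ a (suc b) false + (n ∸ a ∸ b) * Φ a b false)
        ≡⟨ rearrange (Φ a b false) (Φ (suc a) b false) (Φ a (suc b) false) (n ∸ a ∸ b) a b ⟩
      insertionSum n Φ a b false ∎
      where
      rearrange : ∀ u v₁ v₂ w k₁ k₂ → u + (k₁ * v₁ + k₂ * v₂ + w * u) ≡ suc w * u + k₁ * v₁ + k₂ * v₂
      rearrange = solve-∀

  ∑-insertions : (g : Fin (suc n) → Fin (suc n) → Fin (suc n)) → (∀ c → Insertion p c f (g c)) → ∀ i j →
                 ∑[ c ∈ allFin (suc n) ] observe Φ (g c) (punchIn p i) (punchIn p j)
                   ≡ insertionSum n Φ (cycleLength f i) (cycleLength f j) (sameCycle f i j)
  ∑-insertions g ins i j = begin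
    ∑[ c ∈ allFin (suc n) ] observe Φ (g c) i↑ j↑
      ≡⟨ ∑-allFin-punchIn p _ ⟩
    observe Φ (g p) i↑ j↑ + ∑[ z ∈ allFin n ] observe Φ (g (punchIn p z)) i↑ j↑
      ≡⟨ cong₂ _+_ fixed-point (∑-cong (allFin n) λ {z} _ → after z) ⟩
    Φ a b s + ∑[ z ∈ allFin n ] Φ (⟦ sameCycle f i z ⟧ + a) (⟦ sameCycle f j z ⟧ + b) s
      ≡⟨ insertionSum-orbits i j ⟩
    insertionSum n Φ a b s ∎
    where
    open ≡-Reasoning
    i↑ = punchIn p i
    j↑ = punchIn p j
    a = cycleLength f i
    b = cycleLength f j
    s = sameCycle f i j
    fixed-point : observe Φ (g p) i↑ j↑ ≡ Φ a b s
    fixed-point = trans (observe-insert (ins p) i j)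
                        (cong₂ (λ u v → Φ (⟦ u ⟧ + a) (⟦ v ⟧ + b) s) (not-reached i) (not-reached j))
      where not-reached = sameCycle-insert-fixed p (ins p) inj refl
    after : ∀ z → observe Φ (g (punchIn p z)) i↑ j↑ ≡ Φ (⟦ sameCycle f i z ⟧ + a) (⟦ sameCycle f j z ⟧ + b) s
    after z = trans (observe-insert (ins (punchIn p z)) i j)
                    (cong₂ (λ u v → Φ (⟦ u ⟧ + a) (⟦ v ⟧ + b) s) (reached i) (reached j))
      where reached = sameCycle-insert-after p (ins (punchIn p z)) inj refl

total-suc : ∀ {n} (p : Fin (suc n)) Φ i j →
            total Φ (suc n) (punchIn p i) (punchIn p j) ≡ total (insertionSum n Φ) n i j
total-suc {n} p Φ i j = begin
  ∑[ π ∈ Sym (suc n) ] observe Φ (lookup π) (punchIn p i) (punchIn p j)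
    ≡⟨ ∑-Sym-suc p _ ⟩
  ∑[ c ∈ allFin (suc n) ] ∑[ π ∈ Sym n ] observe Φ (lookup (insertᵛ p π c)) (punchIn p i) (punchIn p j)
    ≡⟨ ∑-comm (allFin (suc n)) (Sym n) _ ⟩
  ∑[ π ∈ Sym n ] ∑[ c ∈ allFin (suc n) ] observe Φ (lookup (insertᵛ p π c)) (punchIn p i) (punchIn p j)
    ≡⟨ ∑-cong (Sym n) (λ {π} π∈ →
         ∑-insertions p Φ (∈-Sym⁻ π∈ _ _) (lookup ∘ insertᵛ p π) (insertᵛ-Insertion p π) i j) ⟩
  ∑[ π ∈ Sym n ] observe (insertionSum n Φ) (lookup π) i j ∎
  where open ≡-Reasoning

inSeparateCycles : ℕ → ℕ → Statistic
inSeparateCycles a b x y false = ⟦ does (x ℕ.≟ a) ∧ does (y ℕ.≟ b) ⟧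
inSeparateCycles a b x y true = 0

inOneCycle : ℕ → Statistic
inOneCycle a x y false = 0
inOneCycle a x y true = ⟦ does (x ℕ.≟ a) ⟧

-- The decision is an argument because `does (x ℕ.≟ a)` reduces to `x ≡ᵇ a`, out of reach of `with`.
≟-subst : (h : A → ℕ) {x a : A} (x≟a : Dec (x ≡ a)) → h x * ⟦ does x≟a ⟧ ≡ h a * ⟦ does x≟a ⟧
≟-subst h (yes refl) = refl
≟-subst h {x} {a} (no _) = trans (*-zeroʳ (h x)) (sym (*-zeroʳ (h a)))

≟-subst₂ : (h : A → B → ℕ) {x a : A} {y b : B} (x≟a : Dec (x ≡ a)) (y≟b : Dec (y ≡ b)) →
           h x y * ⟦ does x≟a ∧ does y≟b ⟧ ≡ h a b * ⟦ does x≟a ∧ does y≟b ⟧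
≟-subst₂ h (yes refl) y≟b = ≟-subst (h _) y≟b
≟-subst₂ h {x} {a} {y} {b} (no _) _ = trans (*-zeroʳ (h x y)) (sym (*-zeroʳ (h a b)))

insertionSum-inSeparateCycles :
  ∀ n a b x y t → insertionSum n (inSeparateCycles (suc a) (suc b)) x y t
    ≡ suc (n ∸ suc a ∸ suc b) * inSeparateCycles (suc a) (suc b) x y t
      + a * inSeparateCycles a (suc b) x y t + b * inSeparateCycles (suc a) b x y t
insertionSum-inSeparateCycles n a b x y true =
  trans (cong₂ _+_ (*-zeroʳ (suc (n ∸ x))) (*-zeroʳ x))
        (sym (cong₂ _+_ (cong₂ _+_ (*-zeroʳ (suc (n ∸ suc a ∸ suc b))) (*-zeroʳ a)) (*-zeroʳ b)))
insertionSum-inSeparateCycles n a b x y false =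
  cong₂ _+_ (cong₂ _+_ (≟-subst₂ (λ x y → suc (n ∸ x ∸ y)) (x ℕ.≟ suc a) (y ℕ.≟ suc b))
                       (≟-subst₂ (λ x _ → x) (x ℕ.≟ a) (y ℕ.≟ suc b)))
            (≟-subst₂ (λ _ y → y) (x ℕ.≟ suc a) (y ℕ.≟ b))

insertionSum-inOneCycle :
  ∀ n a x y t → insertionSum n (inOneCycle (suc a)) x y t
    ≡ suc (n ∸ suc a) * inOneCycle (suc a) x y t + a * inOneCycle a x y t
insertionSum-inOneCycle n a x y true =
  cong₂ _+_ (≟-subst (λ x → suc (n ∸ x)) (x ℕ.≟ suc a)) (≟-subst id (x ℕ.≟ a))
insertionSum-inOneCycle n a x y false =
  trans (cong₂ _+_ (cong₂ _+_ (*-zeroʳ (suc (n ∸ x ∸ y))) (*-zeroʳ x)) (*-zeroʳ y))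
        (sym (cong₂ _+_ (*-zeroʳ (suc (n ∸ suc a))) (*-zeroʳ a)))

total-insertionSum-inSeparateCycles :
  ∀ n a b (i j : Fin n) → total (insertionSum n (inSeparateCycles (suc a) (suc b))) n i j
    ≡ suc (n ∸ suc a ∸ suc b) * total (inSeparateCycles (suc a) (suc b)) n i j
      + a * total (inSeparateCycles a (suc b)) n i j + b * total (inSeparateCycles (suc a) b) n i j
total-insertionSum-inSeparateCycles n a b i j =
  trans (∑-cong (Sym n) λ {π} _ → insertionSum-inSeparateCycles n a b _ _ (sameCycle (lookup π) i j))
        (∑-linear₃ (Sym n) (suc (n ∸ suc a ∸ suc b)) a b
                   (observe′ (suc a) (suc b)) (observe′ a (suc b)) (observe′ (suc a) b))
  where
  observe′ : ℕ → ℕ → Vec (Fin n) n → ℕ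
  observe′ a b π = observe (inSeparateCycles a b) (lookup π) i j

total-insertionSum-inOneCycle :
  ∀ n a (i j : Fin n) → total (insertionSum n (inOneCycle (suc a))) n i j
    ≡ suc (n ∸ suc a) * total (inOneCycle (suc a)) n i j + a * total (inOneCycle a) n i j
total-insertionSum-inOneCycle n a i j =
  trans (∑-cong (Sym n) λ {π} _ → insertionSum-inOneCycle n a _ _ (sameCycle (lookup π) i j))
        (∑-linear (Sym n) (suc (n ∸ suc a)) a (observe′ (suc a)) (observe′ a))
  where
  observe′ : ℕ → Vec (Fin n) n → ℕ
  observe′ a π = observe (inOneCycle a) (lookup π) i j

≤?-suc : ∀ t m → does (suc t ℕ.≤? suc m) ≡ does (t ℕ.≤? m)
≤?-suc t m = does-⇔ (mk⇔ s≤s⁻¹ s≤s) (suc t ℕ.≤? suc m) (t ℕ.≤? m)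

-- The decisions are arguments for the same reason as in ≟-subst.
≤-indicator-step : ∀ {t m} F (t≤?m : Dec (t ≤ m)) (t≤?1+m : Dec (t ≤ suc m)) →
                   suc (m ∸ t) * (⟦ does t≤?m ⟧ * F) + t * (⟦ does t≤?1+m ⟧ * F) ≡ ⟦ does t≤?1+m ⟧ * (suc m * F)
≤-indicator-step {t} {m} F (yes t≤m) (yes _) = begin
  suc (m ∸ t) * (1 * F) + t * (1 * F) ≡⟨ *-distribʳ-+ (1 * F) (suc (m ∸ t)) t ⟨
  (suc (m ∸ t) + t) * (1 * F)         ≡⟨ cong (λ k → suc k * (1 * F)) (m∸n+n≡m t≤m) ⟩
  suc m * (1 * F)                     ≡⟨ cong (suc m *_) (*-identityˡ F) ⟩
  suc m * F                           ≡⟨ *-identityˡ (suc m * F) ⟨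
  1 * (suc m * F)                     ∎
  where open ≡-Reasoning
≤-indicator-step F (yes t≤m) (no t≰1+m) = contradiction (m≤n⇒m≤1+n t≤m) t≰1+m
≤-indicator-step {t} {m} F (no t≰m) (yes t≤1+m) = begin
  suc (m ∸ t) * 0 + t * (1 * F) ≡⟨ cong (_+ t * (1 * F)) (*-zeroʳ (suc (m ∸ t))) ⟩
  t * (1 * F)                   ≡⟨ cong (_* (1 * F)) (≤-antisym t≤1+m (≰⇒> t≰m)) ⟩
  suc m * (1 * F)               ≡⟨ cong (suc m *_) (*-identityˡ F) ⟩
  suc m * F                     ≡⟨ *-identityˡ (suc m * F) ⟨
  1 * (suc m * F)               ∎
  where open ≡-Reasoning
≤-indicator-step {t} {m} F (no _) (no _) = cong₂ _+_ (*-zeroʳ (suc (m ∸ t))) (*-zeroʳ t)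

avoid-two : ∀ {m} (i j : Fin (3 + m)) → ∃ λ p → p ≢ i × p ≢ j
avoid-two zero zero = suc zero , (λ ()) , (λ ())
avoid-two zero (suc zero) = suc (suc zero) , (λ ()) , (λ ())
avoid-two zero (suc (suc j)) = suc zero , (λ ()) , (λ ())
avoid-two (suc zero) zero = suc (suc zero) , (λ ()) , (λ ())
avoid-two (suc zero) (suc j) = zero , (λ ()) , (λ ())
avoid-two (suc (suc i)) zero = suc zero , (λ ()) , (λ ())
avoid-two (suc (suc i)) (suc j) = zero , (λ ()) , (λ ())

record Reduction {m} (i j : Fin (3 + m)) : Set where
  field
    i′ j′ : Fin (2 + m)
    i′≢j′ : i′ ≢ j′
    reduce : ∀ Φ → total Φ (3 + m) i j ≡ total (insertionSum (2 + m) Φ) (2 + m) i′ j′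

reduction : ∀ {m} {i j : Fin (3 + m)} → i ≢ j → Reduction i j
reduction {i = i} {j} i≢j = record
  { i′ = punchOut p≢i
  ; j′ = punchOut p≢j
  ; i′≢j′ = i≢j ∘ punchOut-injective p≢i p≢j
  ; reduce = λ Φ → trans (cong₂ (total Φ _) (sym (punchIn-punchOut p≢i)) (sym (punchIn-punchOut p≢j)))
                         (total-suc p Φ (punchOut p≢i) (punchOut p≢j))
  }
  where
  p = proj₁ (avoid-two i j)
  p≢i = proj₁ (proj₂ (avoid-two i j))
  p≢j = proj₂ (proj₂ (avoid-two i j))

total-inSeparateCycles : ∀ m (i j : Fin (2 + m)) → i ≢ j → ∀ a b →
                         total (inSeparateCycles (suc a) (suc b)) (2 + m) i j ≡ ⟦ does (a + b ℕ.≤? m) ⟧ * m !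
total-inSeparateCycles zero zero zero i≢j = contradiction refl i≢j
total-inSeparateCycles zero zero (suc zero) _ zero zero = refl
total-inSeparateCycles zero zero (suc zero) _ zero (suc b) = refl
total-inSeparateCycles zero zero (suc zero) _ (suc a) b = refl
total-inSeparateCycles zero (suc zero) zero _ zero zero = refl
total-inSeparateCycles zero (suc zero) zero _ zero (suc b) = refl
total-inSeparateCycles zero (suc zero) zero _ (suc a) b = refl
total-inSeparateCycles zero (suc zero) (suc zero) i≢j = contradiction refl i≢j
total-inSeparateCycles (suc m) i j i≢j a b = begin
  total (inSeparateCycles (suc a) (suc b)) (3 + m) i j
    ≡⟨ reduce _ ⟩
  total (insertionSum (2 + m) (inSeparateCycles (suc a) (suc b))) (2 + m) i′ j′
    ≡⟨ total-insertionSum-inSeparateCycles (2 + m) a b i′ j′ ⟩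
  k * T (suc a) (suc b) + a * T a (suc b) + b * T (suc a) b
    ≡⟨ cong₂ _+_ (cong₂ _+_ (cong (k *_) (IH a b)) (shift-a a)) (shift-b b) ⟩
  k * X + a * Y + b * Y
    ≡⟨ +-assoc (k * X) (a * Y) (b * Y) ⟩
  k * X + (a * Y + b * Y)
    ≡⟨ cong₂ _+_ (cong (_* X) k≡) (sym (*-distribʳ-+ Y a b)) ⟩
  suc (m ∸ (a + b)) * X + (a + b) * Y
    ≡⟨ ≤-indicator-step (m !) (a + b ℕ.≤? m) (a + b ℕ.≤? suc m) ⟩
  ⟦ does (a + b ℕ.≤? suc m) ⟧ * suc m ! ∎
  where
  open ≡-Reasoning
  open Reduction (reduction i≢j)
  IH = total-inSeparateCycles m i′ j′ i′≢j′
  k = suc (2 + m ∸ suc a ∸ suc b)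
  X = ⟦ does (a + b ℕ.≤? m) ⟧ * m !
  Y = ⟦ does (a + b ℕ.≤? suc m) ⟧ * m !
  T : ℕ → ℕ → ℕ
  T a b = total (inSeparateCycles a b) (2 + m) i′ j′
  k≡ : k ≡ suc (m ∸ (a + b))
  k≡ = cong suc (trans (∸-+-assoc (suc m) a (suc b)) (cong (suc m ∸_) (+-suc a b)))
  shift-a : ∀ a → a * T a (suc b) ≡ a * (⟦ does (a + b ℕ.≤? suc m) ⟧ * m !)
  shift-a zero = refl
  shift-a (suc a) = cong (suc a *_) (trans (IH a b) (cong (λ u → ⟦ u ⟧ * m !) (sym (≤?-suc (a + b) m))))
  shift-b : ∀ b → b * T (suc a) b ≡ b * (⟦ does (a + b ℕ.≤? suc m) ⟧ * m !)
  shift-b zero = refl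
  shift-b (suc b) = cong (suc b *_) (trans (IH a b) (cong (λ u → ⟦ u ⟧ * m !)
    (trans (sym (≤?-suc (a + b) m)) (cong (λ t → does (t ℕ.≤? suc m)) (sym (+-suc a b))))))

total-inOneCycle : ∀ m (i j : Fin (2 + m)) → i ≢ j → ∀ a →
                   total (inOneCycle (suc a)) (2 + m) i j ≡ a * (⟦ does (a ℕ.≤? suc m) ⟧ * m !)
total-inOneCycle zero zero zero i≢j = contradiction refl i≢j
total-inOneCycle zero zero (suc zero) _ zero = refl
total-inOneCycle zero zero (suc zero) _ (suc zero) = refl
total-inOneCycle zero zero (suc zero) _ (suc (suc a)) = sym (*-zeroʳ (suc (suc a)))
total-inOneCycle zero (suc zero) zero _ zero = refl
total-inOneCycle zero (suc zero) zero _ (suc zero) = refl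
total-inOneCycle zero (suc zero) zero _ (suc (suc a)) = sym (*-zeroʳ (suc (suc a)))
total-inOneCycle zero (suc zero) (suc zero) i≢j = contradiction refl i≢j
total-inOneCycle (suc m) i j i≢j a = begin
  total (inOneCycle (suc a)) (3 + m) i j
    ≡⟨ reduce _ ⟩
  total (insertionSum (2 + m) (inOneCycle (suc a))) (2 + m) i′ j′
    ≡⟨ total-insertionSum-inOneCycle (2 + m) a i′ j′ ⟩
  suc (suc m ∸ a) * T (suc a) + a * T a
    ≡⟨ cong (λ t → suc (suc m ∸ a) * t + a * T a) (IH a) ⟩
  suc (suc m ∸ a) * (a * (⟦ does (a ℕ.≤? suc m) ⟧ * m !)) + a * T a
    ≡⟨ step a ⟩
  a * (⟦ does (a ℕ.≤? suc (suc m)) ⟧ * suc m !) ∎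
  where
  open ≡-Reasoning
  open Reduction (reduction i≢j)
  IH = total-inOneCycle m i′ j′ i′≢j′
  T : ℕ → ℕ
  T a = total (inOneCycle a) (2 + m) i′ j′
  factor : ∀ x y z k → x * (k * y) + k * z ≡ k * (x * y + z)
  factor = solve-∀
  step : ∀ a → suc (suc m ∸ a) * (a * (⟦ does (a ℕ.≤? suc m) ⟧ * m !)) + a * T a
                 ≡ a * (⟦ does (a ℕ.≤? suc (suc m)) ⟧ * suc m !)
  step zero = trans (+-identityʳ _) (*-zeroʳ (suc (suc m)))
  step (suc a) = begin
    suc (m ∸ a) * (suc a * (⟦ does (suc a ℕ.≤? suc m) ⟧ * m !)) + suc a * T (suc a)
      ≡⟨ cong₂ (λ u t → suc (m ∸ a) * (suc a * (⟦ u ⟧ * m !)) + suc a * t) (≤?-suc a m) (IH a) ⟩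
    suc (m ∸ a) * (suc a * (⟦ does (a ℕ.≤? m) ⟧ * m !)) + suc a * (a * (⟦ does (a ℕ.≤? suc m) ⟧ * m !))
      ≡⟨ factor (suc (m ∸ a)) (⟦ does (a ℕ.≤? m) ⟧ * m !) (a * (⟦ does (a ℕ.≤? suc m) ⟧ * m !)) (suc a) ⟩
    suc a * (suc (m ∸ a) * (⟦ does (a ℕ.≤? m) ⟧ * m !) + a * (⟦ does (a ℕ.≤? suc m) ⟧ * m !))
      ≡⟨ cong (suc a *_) (≤-indicator-step (m !) (a ℕ.≤? m) (a ℕ.≤? suc m)) ⟩
    suc a * (⟦ does (a ℕ.≤? suc m) ⟧ * suc m !)
      ≡⟨ cong (λ u → suc a * (⟦ u ⟧ * suc m !)) (≤?-suc a (suc m)) ⟨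
    suc a * (⟦ does (suc a ℕ.≤? suc (suc m)) ⟧ * suc m !) ∎

∑-≟-∉ : (eq? : DecidableEquality A) {xs : List A} (x : A) → ¬ x ∈ xs → ∑[ a ∈ xs ] ⟦ does (eq? x a) ⟧ ≡ 0
∑-≟-∉ eq? {[]} x _ = refl
∑-≟-∉ eq? {a ∷ xs} x x∉ = cong₂ _+_ (cong ⟦_⟧ (dec-false (eq? x a) (x∉ ∘ here))) (∑-≟-∉ eq? x (x∉ ∘ there))

∑-≟-∈ : (eq? : DecidableEquality A) {xs : List A} → Unique xs → ∀ {x} → x ∈ xs →
        ∑[ a ∈ xs ] ⟦ does (eq? x a) ⟧ ≡ 1
∑-≟-∈ eq? (a∉ ∷ xs!) (here refl) =
  cong₂ _+_ (cong ⟦_⟧ (dec-true (eq? _ _) refl)) (∑-≟-∉ eq? _ (Unique.Unique[x∷xs]⇒x∉xs (a∉ ∷ xs!)))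
∑-≟-∈ eq? (a∉ ∷ xs!) {x} (there x∈) =
  cong₂ _+_ (cong ⟦_⟧ (dec-false (eq? x _) λ { refl → Unique.Unique[x∷xs]⇒x∉xs (a∉ ∷ xs!) x∈ }))
            (∑-≟-∈ eq? xs! x∈)

⟦∧⟧ : ∀ u v → ⟦ u ∧ v ⟧ ≡ ⟦ u ⟧ * ⟦ v ⟧
⟦∧⟧ true true = refl
⟦∧⟧ true false = refl
⟦∧⟧ false v = refl

module _ (k : ℕ) where

  divisors-unique : Unique (divisors k)
  divisors-unique = Unique.filter⁺ (_∣? k) (Unique.map⁺ ℕ.suc-injective (Unique.upTo⁺ k))

  ∈-divisors⁻ : ∀ {a} → a ∈ divisors k → ∃ λ a′ → a ≡ suc a′ × a′ < k
  ∈-divisors⁻ a∈ with ∈-map⁻ suc (proj₁ (∈-filter⁻ (_∣? k) {xs = map suc (upTo k)} a∈))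
  ... | a′ , a′∈ , refl = a′ , refl , ∈-upTo⁻ a′∈

  σ≡∑pred+τ : σ k ≡ ∑[ a ∈ divisors k ] (a ∸ 1) + τ k
  σ≡∑pred+τ = begin
    sum D                             ≡⟨ cong sum (map-id D) ⟨
    ∑[ a ∈ D ] a                      ≡⟨ ∑-cong D (λ a∈ → sym (m∸n+n≡m (pos a∈))) ⟩
    ∑[ a ∈ D ] (a ∸ 1 + 1)            ≡⟨ ∑-distrib-+ D (_∸ 1) (λ _ → 1) ⟩
    ∑[ a ∈ D ] (a ∸ 1) + ∑[ _ ∈ D ] 1 ≡⟨ cong (∑[ a ∈ D ] (a ∸ 1) +_) (trans (∑-const D 1) (*-identityʳ _)) ⟩
    ∑[ a ∈ D ] (a ∸ 1) + length D     ∎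
    where
    open ≡-Reasoning
    D = divisors k
    pos : ∀ {a} → a ∈ D → 1 ≤ a
    pos a∈ with ∈-divisors⁻ a∈
    ... | _ , refl , _ = s≤s z≤n

  module _ (k≥1 : 1 ≤ k) where

    ∑-divisors-≟ : ∀ x → 1 ≤ x → ∑[ a ∈ divisors k ] ⟦ does (x ℕ.≟ a) ⟧ ≡ ⟦ does (x ∣? k) ⟧
    ∑-divisors-≟ (suc x) _ = by-cases (suc x ∣? k)
      where
      by-cases : (d : Dec (suc x ∣ k)) → ∑[ a ∈ divisors k ] ⟦ does (suc x ℕ.≟ a) ⟧ ≡ ⟦ does d ⟧
      by-cases (yes x∣k) = ∑-≟-∈ ℕ._≟_ divisors-unique
        (∈-filter⁺ (_∣? k) (∈-map⁺ suc (∈-upTo⁺ (∣⇒≤ ⦃ ≢-nonZero k≢0 ⦄ x∣k))) x∣k)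
        where k≢0 = λ k≡0 → contradiction (subst (1 ≤_) k≡0 k≥1) λ ()
      by-cases (no x∤k) = ∑-≟-∉ ℕ._≟_ (suc x) (x∤k ∘ proj₂ ∘ ∈-filter⁻ (_∣? k) {xs = map suc (upTo k)})

    divisibility-split : ∀ {x y} → 1 ≤ x → 1 ≤ y → ∀ s → (s ≡ true → x ≡ y) →
                         ⟦ does (x ∣? k) ∧ does (y ∣? k) ⟧
                           ≡ ∑[ a ∈ divisors k ] ∑[ b ∈ divisors k ] inSeparateCycles a b x y s
                             + ∑[ a ∈ divisors k ] inOneCycle a x y s
    divisibility-split {x} {y} x≥1 y≥1 false _ = begin
      ⟦ does (x ∣? k) ∧ does (y ∣? k) ⟧ ≡⟨ ⟦∧⟧ (does (x ∣? k)) (does (y ∣? k)) ⟩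
      ⟦ does (x ∣? k) ⟧ * ⟦ does (y ∣? k) ⟧
        ≡⟨ cong₂ _*_ (∑-divisors-≟ x x≥1) (∑-divisors-≟ y y≥1) ⟨
      ∑[ a ∈ D ] ⟦ does (x ℕ.≟ a) ⟧ * ∑[ b ∈ D ] ⟦ does (y ℕ.≟ b) ⟧
        ≡⟨ ∑-*ʳ D _ _ ⟨
      ∑[ a ∈ D ] (⟦ does (x ℕ.≟ a) ⟧ * ∑[ b ∈ D ] ⟦ does (y ℕ.≟ b) ⟧)
        ≡⟨ ∑-cong D (λ {a} _ → trans (sym (∑-*ˡ D ⟦ does (x ℕ.≟ a) ⟧ (λ b → ⟦ does (y ℕ.≟ b) ⟧)))
                                     (∑-cong D λ {b} _ → sym (⟦∧⟧ (does (x ℕ.≟ a)) (does (y ℕ.≟ b))))) ⟩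
      ∑[ a ∈ D ] ∑[ b ∈ D ] ⟦ does (x ℕ.≟ a) ∧ does (y ℕ.≟ b) ⟧
        ≡⟨ +-identityʳ _ ⟨
      ∑[ a ∈ D ] ∑[ b ∈ D ] ⟦ does (x ℕ.≟ a) ∧ does (y ℕ.≟ b) ⟧ + 0
        ≡⟨ cong (∑[ a ∈ D ] ∑[ b ∈ D ] ⟦ does (x ℕ.≟ a) ∧ does (y ℕ.≟ b) ⟧ +_) (∑-zero D) ⟨
      ∑[ a ∈ D ] ∑[ b ∈ D ] inSeparateCycles a b x y false + ∑[ a ∈ D ] inOneCycle a x y false ∎
      where
      open ≡-Reasoning
      D = divisors k
    divisibility-split {x} x≥1 _ true x≡y rewrite sym (x≡y refl) = begin
      ⟦ does (x ∣? k) ∧ does (x ∣? k) ⟧                       ≡⟨ cong ⟦_⟧ (∧-idem (does (x ∣? k))) ⟩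
      ⟦ does (x ∣? k) ⟧                                       ≡⟨ ∑-divisors-≟ x x≥1 ⟨
      ∑[ a ∈ D ] ⟦ does (x ℕ.≟ a) ⟧
        ≡⟨ cong (_+ ∑[ a ∈ D ] ⟦ does (x ℕ.≟ a) ⟧) no-separate ⟨
      ∑[ a ∈ D ] ∑[ b ∈ D ] inSeparateCycles a b x x true + ∑[ a ∈ D ] inOneCycle a x x true ∎
      where
      open ≡-Reasoning
      D = divisors k
      no-separate : ∑[ a ∈ D ] ∑[ b ∈ D ] 0 ≡ 0
      no-separate = trans (∑-cong D λ _ → ∑-zero D) (∑-zero D)

pow≡^ : ∀ {n} (π : Vec (Fin n) n) k x → pow π k x ≡ (lookup π ^ k) x
pow≡^ π zero x = refl
pow≡^ π (suc k) x = cong (lookup π) (pow≡^ π k x)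

pow-fixed⇔ : ∀ {n} {π : Vec (Fin n) n} → IsPerm π → ∀ k x → pow π k x ≡ x ⇔ cycleLength (lookup π) x ∣ k
pow-fixed⇔ {π = π} perm k x = mk⇔ (λ fixed → to (trans (sym (pow≡^ π k x)) fixed))
                                  (λ c∣k → trans (pow≡^ π k x) (from c∣k))
  where open Equivalence (fixed⇔cycleLength∣ (lookup π) (perm _ _) k x)

countFix2≡totals : ∀ {n k} (i j : Fin n) → 1 ≤ k →
                   countFix2 n k i j
                     ≡ ∑[ a ∈ divisors k ] ∑[ b ∈ divisors k ] total (inSeparateCycles a b) n i j
                       + ∑[ a ∈ divisors k ] total (inOneCycle a) n i j
countFix2≡totals {n} {k} i j k≥1 = begin
  countFix2 n k i j
    ≡⟨ length-filter (λ π → (pow π k i ≟ i) ×-dec (pow π k j ≟ j)) (Sym n) ⟩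
  ∑[ π ∈ Sym n ] ⟦ does (pow π k i ≟ i) ∧ does (pow π k j ≟ j) ⟧
    ≡⟨ ∑-cong (Sym n) (λ π∈ → split (∈-Sym⁻ π∈)) ⟩
  ∑[ π ∈ Sym n ] (∑[ a ∈ D ] ∑[ b ∈ D ] observe (inSeparateCycles a b) (lookup π) i j
                  + ∑[ a ∈ D ] observe (inOneCycle a) (lookup π) i j)
    ≡⟨ ∑-distrib-+ (Sym n) _ _ ⟩
  ∑[ π ∈ Sym n ] ∑[ a ∈ D ] ∑[ b ∈ D ] observe (inSeparateCycles a b) (lookup π) i j
    + ∑[ π ∈ Sym n ] ∑[ a ∈ D ] observe (inOneCycle a) (lookup π) i j
    ≡⟨ cong₂ _+_ (trans (∑-comm (Sym n) D _) (∑-cong D λ {a} _ → ∑-comm (Sym n) D _)) (∑-comm (Sym n) D _) ⟩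
  ∑[ a ∈ D ] ∑[ b ∈ D ] total (inSeparateCycles a b) n i j + ∑[ a ∈ D ] total (inOneCycle a) n i j ∎
  where
  open ≡-Reasoning
  D = divisors k
  split : ∀ {π} → IsPerm π → ⟦ does (pow π k i ≟ i) ∧ does (pow π k j ≟ j) ⟧
            ≡ ∑[ a ∈ D ] ∑[ b ∈ D ] observe (inSeparateCycles a b) (lookup π) i j
              + ∑[ a ∈ D ] observe (inOneCycle a) (lookup π) i j
  split {π} perm = trans
    (cong ⟦_⟧ (cong₂ _∧_ (does-⇔ (pow-fixed⇔ perm k i) (pow π k i ≟ i) (_ ∣? k))
                          (does-⇔ (pow-fixed⇔ perm k j) (pow π k j ≟ j) (_ ∣? k))))
    (divisibility-split k k≥1 (s≤s z≤n) (s≤s z≤n) (sameCycle f i j)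
                        (cycleLength-orbit f (perm _ _) ∘ sameCycle⇒InOrbit f (perm _ _)))
    where f = lookup π

divisor-pair-bound : ∀ {k m a b} → 2 * k + 1 ≤ 2 + m → a < k → b < k → a + b ≤ m
divisor-pair-bound {k} {m} {a} {b} bound a<k b<k = begin
  a + b     ≤⟨ +-monoʳ-≤ a (n≤1+n b) ⟩
  a + suc b ≤⟨ s≤s⁻¹ (begin
    suc a + suc b ≤⟨ +-mono-≤ a<k b<k ⟩
    k + k         ≡⟨ cong (k +_) (+-identityʳ k) ⟨
    2 * k         ≤⟨ s≤s⁻¹ (subst (_≤ 2 + m) (+-comm (2 * k) 1) bound) ⟩
    suc m         ∎) ⟩
  m         ∎
  where open ≤-Reasoning

module _ (k m : ℕ) (bound : 2 * k + 1 ≤ 2 + m) {i j : Fin (2 + m)} (i≢j : i ≢ j) where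

  total-inSeparateCycles-divisors : ∀ {a b} → a ∈ divisors k → b ∈ divisors k →
                                    total (inSeparateCycles a b) (2 + m) i j ≡ m !
  total-inSeparateCycles-divisors a∈ b∈ with ∈-divisors⁻ k a∈ | ∈-divisors⁻ k b∈
  ... | a′ , refl , a′<k | b′ , refl , b′<k = begin
    total (inSeparateCycles (suc a′) (suc b′)) (2 + m) i j ≡⟨ total-inSeparateCycles m i j i≢j a′ b′ ⟩
    ⟦ does (a′ + b′ ℕ.≤? m) ⟧ * m !                      ≡⟨ cong (λ u → ⟦ u ⟧ * m !) (dec-true (_ ℕ.≤? m) a′+b′≤m) ⟩
    1 * m !                                              ≡⟨ *-identityˡ (m !) ⟩
    m !                                                  ∎
    where
    open ≡-Reasoning
    a′+b′≤m = divisor-pair-bound {k} {m} bound a′<k b′<k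

  total-inOneCycle-divisor : ∀ {a} → a ∈ divisors k → total (inOneCycle a) (2 + m) i j ≡ (a ∸ 1) * m !
  total-inOneCycle-divisor a∈ with ∈-divisors⁻ k a∈
  ... | a′ , refl , a′<k = begin
    total (inOneCycle (suc a′)) (2 + m) i j ≡⟨ total-inOneCycle m i j i≢j a′ ⟩
    a′ * (⟦ does (a′ ℕ.≤? suc m) ⟧ * m !) ≡⟨ cong (λ u → a′ * (⟦ u ⟧ * m !)) (dec-true (a′ ℕ.≤? suc m) a′≤1+m) ⟩
    a′ * (1 * m !)                        ≡⟨ cong (a′ *_) (*-identityˡ (m !)) ⟩
    a′ * m !                              ∎
    where
    open ≡-Reasoning
    a′≤1+m = ≤-trans (m≤m+n a′ a′) (m≤n⇒m≤1+n (divisor-pair-bound {k} {m} bound a′<k a′<k))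

n≤n*n : ∀ n → n ≤ n * n
n≤n*n zero = z≤n
n≤n*n (suc n) = m≤m*n (suc n) (suc n)

square-arithmetic : ∀ t s F → (t * t ∸ t + (s + t)) * F ≡ t * (t * F) + s * F
square-arithmetic t s F = begin
  (t * t ∸ t + (s + t)) * F ≡⟨ cong (λ u → (t * t ∸ t + u) * F) (+-comm s t) ⟩
  (t * t ∸ t + (t + s)) * F ≡⟨ cong (_* F) (+-assoc (t * t ∸ t) t s) ⟨
  (t * t ∸ t + t + s) * F   ≡⟨ cong (λ u → (u + s) * F) (m∸n+n≡m (n≤n*n t)) ⟩
  (t * t + s) * F           ≡⟨ expand t s F ⟩
  t * (t * F) + s * F       ∎
  where
  open ≡-Reasoning
  expand : ∀ t s F → (t * t + s) * F ≡ t * (t * F) + s * F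
  expand = solve-∀

lemma2p5 : (k n : ℕ) → 1 ≤ k → 2 * k + 1 ≤ n → (i j : Fin n) → i ≢ j →
    countFix2 n k i j ≡ (τ k * τ k ∸ τ k + σ k) * (n ∸ 2) !
lemma2p5 k (suc (suc m)) k≥1 bound i j i≢j = begin
  countFix2 (2 + m) k i j
    ≡⟨ countFix2≡totals i j k≥1 ⟩
  ∑[ a ∈ D ] ∑[ b ∈ D ] total (inSeparateCycles a b) (2 + m) i j + ∑[ a ∈ D ] total (inOneCycle a) (2 + m) i j
    ≡⟨ cong₂ _+_ (∑-cong D λ a∈ → ∑-cong D λ b∈ → total-inSeparateCycles-divisors k m bound i≢j a∈ b∈)
                 (∑-cong D (total-inOneCycle-divisor k m bound i≢j)) ⟩
  ∑[ a ∈ D ] ∑[ b ∈ D ] (m !) + ∑[ a ∈ D ] ((a ∸ 1) * m !)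
    ≡⟨ cong₂ _+_ (trans (∑-cong D λ _ → ∑-const D (m !)) (∑-const D _)) (∑-*ʳ D (_∸ 1) (m !)) ⟩
  τ k * (τ k * m !) + ∑[ a ∈ D ] (a ∸ 1) * m !
    ≡⟨ square-arithmetic (τ k) (∑[ a ∈ D ] (a ∸ 1)) (m !) ⟨
  (τ k * τ k ∸ τ k + (∑[ a ∈ D ] (a ∸ 1) + τ k)) * m !
    ≡⟨ cong (λ s → (τ k * τ k ∸ τ k + s) * m !) (σ≡∑pred+τ k) ⟨
  (τ k * τ k ∸ τ k + σ k) * m ! ∎
  where
  open ≡-Reasoning
  D = divisors k
lemma2p5 k (suc zero) _ _ zero zero i≢j = contradiction refl i≢j
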